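{- Let $n \ge 2$. For every tree $t$ on $n$ vertices, $$D_{max}^t \le D_{max}^{b\text{ - }bistar} = \frac{1}{4}\left(3(n-1)^2 + 1 - (n \bmod 2)\right),$$ where $D_{max}^{b\text{ - }bistar}$ denotes $D_{max}$ of the balanced bistar tree on $n$ vertices.
   Context: A linear arrangement of a graph $g$ on $n$ vertices is a bijection $\pi$ from its vertex set to $\{1,\dots,n\}$. The sum of edge lengths is $D^g(\pi)=\sum_{\{u,v\}\in E(g)}|\pi(u)-\pi(v)|$. $D_{max}^g$ (resp. $D_{min}^g$) is the maximum (resp. minimum) of $D^g(\pi)$ over all $n!$ linear arrangements. A bistar tree on $n\ge 2$ vertices is a tree obtained by taking two star trees (a star on $s$ vertices is a tree with one vertex adjacent to all other $s-1$ vertices; a star on 1 vertex is a single vertex) with $s_1$ and $s_2$ vertices, $s_1+s_2=n$, and adding an edge between their hubs; its maximum degree is $k_1=\max(s_1,s_2)$ and the other hub has degree $n-k_1$. The balanced bistar tree on $n$ vertices is the bistar tree with $k_1=\lceil n/2\rceil$. -}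

module Defs where

open import Data.Bool using (Bool; true; false; _∧_; _∨_; if_then_else_)
open import Data.Nat using (ℕ; zero; suc; _+_; _*_; _∸_; _^_; _≤_; _<_; ∣_-_∣; _/_; _%_; _≡ᵇ_; _<ᵇ_)
open import Data.Fin using (Fin; toℕ)
open import Data.Fin.Permutation using (Permutation′; _⟨$⟩ʳ_)
open import Data.List using (List; []; _∷_; _++_; [_]; length; map; allFin)
open import Data.Nat.ListAction using (sum)
open import Data.List.Relation.Unary.Linked using (Linked)
open import Data.List.Relation.Unary.Unique.Propositional using (Unique)
open import Data.Product using (Σ; ∃; _×_)
open import Relation.Binary.PropositionalEquality using (_≡_)
open import Relation.Binary.Construct.Closure.ReflexiveTransitive using (Star)
open import Relation.Nullary using (¬_)

-- A (simple, undirected) graph on vertex set Fin n, given by a Boolean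
-- adjacency relation; symmetry and irreflexivity are part of IsTree below.
Graph : ℕ → Set
Graph n = Fin n → Fin n → Bool

Adj : ∀ {n} → Graph n → Fin n → Fin n → Set
Adj g u v = g u v ≡ true

IsSimple : ∀ {n} → Graph n → Set
IsSimple {n} g = (∀ (u v : Fin n) → g u v ≡ g v u) × (∀ (u : Fin n) → g u u ≡ false)

Connected : ∀ {n} → Graph n → Set
Connected {n} g = ∀ (u v : Fin n) → Star (Adj g) u v

IsCycle : ∀ {n} → Graph n → List (Fin n) → Set
IsCycle g [] = Data.Empty.⊥ where import Data.Empty
IsCycle g (v ∷ vs) = (2 ≤ length vs) × Unique (v ∷ vs) × Linked (Adj g) (v ∷ vs ++ [ v ])

Acyclic : ∀ {n} → Graph n → Set
Acyclic {n} g = ∀ (c : List (Fin n)) → ¬ IsCycle g c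

IsTree : ∀ {n} → Graph n → Set
IsTree g = IsSimple g × Connected g × Acyclic g

ΣFin : (n : ℕ) → (Fin n → ℕ) → ℕ
ΣFin n f = sum (map f (allFin n))

-- Linear arrangements: bijections Fin n → Fin n (positions 0..n-1 instead of
-- 1..n; only differences of positions matter).
Arrangement : ℕ → Set
Arrangement n = Permutation′ n

D : ∀ {n} → Graph n → Arrangement n → ℕ
D {n} g π = ΣFin n λ u → ΣFin n λ v →
  if g u v ∧ (toℕ u <ᵇ toℕ v)
  then ∣ toℕ (π ⟨$⟩ʳ u) - toℕ (π ⟨$⟩ʳ v) ∣
  else 0

IsDmax : ∀ {n} → Graph n → ℕ → Set
IsDmax {n} g m = (∃ λ (π : Arrangement n) → D g π ≡ m) × (∀ (π : Arrangement n) → D g π ≤ m)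

⌈_/2⌉ : ℕ → ℕ
⌈ n /2⌉ = (n + 1) / 2

-- Bistar with hubs 0 and k (k ≥ 1): star on vertices {0,…,k-1} with hub 0,
-- star on vertices {k,…,n-1} with hub k, plus the edge {0,k}.
-- Directed "half" of the edge relation on vertex labels:
bistarHalf : ℕ → ℕ → ℕ → Bool
bistarHalf k a b =
     ((a ≡ᵇ 0) ∧ (0 <ᵇ b) ∧ (b <ᵇ k))
  ∨ ((a ≡ᵇ k) ∧ (k <ᵇ b))
  ∨ ((a ≡ᵇ 0) ∧ (b ≡ᵇ k))

bistar : (n k : ℕ) → Graph n
bistar n k u v = bistarHalf k (toℕ u) (toℕ v) ∨ bistarHalf k (toℕ v) (toℕ u)

balancedBistar : (n : ℕ) → Graph n
balancedBistar n = bistar n ⌈ n /2⌉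

-- (3(n-1)^2 + 1 - (n mod 2)) / 4  (the division is exact)
dmaxFormula : ℕ → ℕ
dmaxFormula n = (3 * (n ∸ 1) ^ 2 + 1 ∸ n % 2) / 4

-- The length of an edge is the number of thresholds k < n that it
-- exceeds, and an edge longer than k has both ends at positions p with p < n-1-k
-- or p > k.  At most min(n, 2(n-1-k)) vertices sit at such positions, and in a
-- forest they span at most that many edges minus one: a nonempty vertex set in
-- which every vertex has two neighbours inside the set contains a cycle, so one
-- can always delete a vertex of degree at most one.  Summing over k gives
-- (3(n-1)^2 + 1 - n mod 2)/4.
--
-- Place the hubs of the balanced bistar at the two ends of the line,
-- the leaves of the left hub next to the right hub and vice versa.  The edges of
-- each hub then have the lengths making up the bound.
module Submission where

open import Data.Bool using (Bool; true; false; _∧_; _∨_; not; if_then_else_; T)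
import Data.Bool.Properties as Bool
open import Data.Empty using (⊥; ⊥-elim)
open import Data.Fin using (Fin; zero; suc; toℕ; fromℕ<)
open import Data.Fin.Permutation using (Permutation′; permutation; _⟨$⟩ʳ_)
import Data.Fin.Properties as Fin
open import Data.List using (List; []; _∷_; _++_; [_]; length; allFin; map; tabulate)
open import Data.List.Membership.Propositional using (_∈_)
open import Data.List.Membership.Propositional.Properties using (∈-∃++)
import Data.List.Properties as List
open import Data.List.Relation.Unary.All as All using (All; []; _∷_)
import Data.List.Relation.Unary.All.Properties as All
open import Data.List.Relation.Unary.AllPairs using ([]; _∷_)
open import Data.List.Relation.Unary.Any using (here; there)
open import Data.List.Relation.Unary.Linked using (Linked; []; [-]; _∷_)
open import Data.List.Relation.Unary.Unique.Propositional using (Unique)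
open import Data.Nat hiding (⌈_/2⌉)
open import Data.Nat.DivMod using (m*n/n≡m; m*n%n≡0; [m+kn]%n≡m%n; +-distrib-/; /-monoˡ-≤)
import Data.Nat.ListAction as List
open import Data.Nat.Properties
open import Data.Nat.Tactic.RingSolver using (solve-∀)
open import Data.Product using (_×_; _,_; ∃; uncurry)
open import Data.Sum using (_⊎_; inj₁; inj₂)
open import Function using (_∘_; id)
open import Relation.Binary.Definitions using (tri<; tri≈; tri>)
open import Relation.Binary.PropositionalEquality hiding ([_])
open import Relation.Nullary using (¬_; does; yes; no; ofʸ)
open import Relation.Nullary.Decidable using (_×-dec_; dec-true; dec-false)

open import Defs
open import Algebra.Properties.CommutativeMonoid.Sum +-0-commutativeMonoid
  using (sum-syntax; sum-cong-≗; ∑-distrib-+; ∑-comm; ∑-permute)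

⟦_⟧ : Bool → ℕ
⟦ true  ⟧ = 1
⟦ false ⟧ = 0

⟦⟧≤1 : ∀ b → ⟦ b ⟧ ≤ 1
⟦⟧≤1 true  = ≤-refl
⟦⟧≤1 false = z≤n

⟦∧⟧≤ : ∀ a b → ⟦ a ∧ b ⟧ ≤ ⟦ a ⟧
⟦∧⟧≤ true  b = ⟦⟧≤1 b
⟦∧⟧≤ false b = z≤n

⟦∨⟧≤ : ∀ a b → ⟦ a ∨ b ⟧ ≤ ⟦ a ⟧ + ⟦ b ⟧
⟦∨⟧≤ true  b = s≤s z≤n
⟦∨⟧≤ false b = ≤-refl

⟦not∨⟧≤ : ∀ a b → ⟦ not (a ∨ b) ⟧ ≤ ⟦ not b ⟧
⟦not∨⟧≤ true  b = z≤n
⟦not∨⟧≤ false b = ≤-refl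

∧-leftComm : ∀ a b c → a ∧ (b ∧ c) ≡ b ∧ (a ∧ c)
∧-leftComm true  b c = refl
∧-leftComm false b c = sym (Bool.∧-zeroʳ b)

∧-true : ∀ {a b} → (a ∧ b) ≡ true → a ≡ true × b ≡ true
∧-true {true} {true} _ = refl , refl

∨-true : ∀ {a b} → (a ∨ b) ≡ true → a ≡ true ⊎ b ≡ true
∨-true {true}  _ = inj₁ refl
∨-true {false} e = inj₂ e

<ᵇ-true⇒< : ∀ {m n} → (m <ᵇ n) ≡ true → m < n
<ᵇ-true⇒< {m} {n} e = <ᵇ⇒< m n (subst T (sym e) _)

≡ᵇ-true⇒≡ : ∀ {m n} → (m ≡ᵇ n) ≡ true → m ≡ n
≡ᵇ-true⇒≡ {m} {n} e = ≡ᵇ⇒≡ m n (subst T (sym e) _)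

ΣFin≡∑ : ∀ n (f : Fin n → ℕ) → ΣFin n f ≡ ∑[ i < n ] f i
ΣFin≡∑ zero    f = refl
ΣFin≡∑ (suc n) f = cong (f zero +_) (begin
  List.sum (map f (tabulate suc))        ≡⟨ cong List.sum (List.map-tabulate suc f) ⟩
  List.sum (tabulate (f ∘ suc))          ≡⟨ cong List.sum (List.map-tabulate id (f ∘ suc)) ⟨
  List.sum (map (f ∘ suc) (allFin n))    ≡⟨ ΣFin≡∑ n (f ∘ suc) ⟩
  ∑[ i < n ] f (suc i)                   ∎)
  where open ≡-Reasoning

∑-mono-≤ : ∀ {n} {f h : Fin n → ℕ} → (∀ i → f i ≤ h i) → ∑[ i < n ] f i ≤ ∑[ i < n ] h i
∑-mono-≤ {zero}  f≤h = z≤n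
∑-mono-≤ {suc n} f≤h = +-mono-≤ (f≤h zero) (∑-mono-≤ (f≤h ∘ suc))

∑-mono-< : ∀ {n} {f h : Fin n → ℕ} → (∀ i → f i ≤ h i) → ∀ j → f j < h j →
           ∑[ i < n ] f i < ∑[ i < n ] h i
∑-mono-< f≤h zero    fj<hj = +-mono-<-≤ fj<hj (∑-mono-≤ (f≤h ∘ suc))
∑-mono-< f≤h (suc j) fj<hj = +-mono-≤-< (f≤h zero) (∑-mono-< (f≤h ∘ suc) j fj<hj)

∑-zero : ∀ {n} {f : Fin n → ℕ} → (∀ i → f i ≡ 0) → ∑[ i < n ] f i ≡ 0
∑-zero {zero}  f≡0 = refl
∑-zero {suc n} f≡0 = cong₂ _+_ (f≡0 zero) (∑-zero (f≡0 ∘ suc))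

∑∑-distrib-+ : ∀ {m n} (f h : Fin m → Fin n → ℕ) →
               ∑[ i < m ] ∑[ j < n ] (f i j + h i j) ≡ ∑[ i < m ] ∑[ j < n ] f i j + ∑[ i < m ] ∑[ j < n ] h i j
∑∑-distrib-+ {m} {n} f h =
  trans (sum-cong-≗ λ i → ∑-distrib-+ (f i) (h i)) (∑-distrib-+ (λ i → ∑[ j < n ] f i j) (λ i → ∑[ j < n ] h i j))

f≤∑f : ∀ {n} (f : Fin n → ℕ) i → f i ≤ ∑[ j < n ] f j
f≤∑f f zero    = m≤m+n _ _
f≤∑f f (suc i) = ≤-trans (f≤∑f (f ∘ suc) i) (m≤n+m _ _)

∑-indicator : ∀ {n} (v : Fin n) c → ∑[ u < n ] (if does (u Fin.≟ v) then c else 0) ≡ c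
∑-indicator {suc n} zero    c = trans (cong (c +_) (∑-zero {n} λ _ → refl)) (+-identityʳ c)
∑-indicator {suc n} (suc v) c = ∑-indicator v c

∑⟦⟧-witness : ∀ {n} (p : Fin n → Bool) → 1 ≤ ∑[ w < n ] ⟦ p w ⟧ → ∃ λ w → p w ≡ true
∑⟦⟧-witness {suc n} p 1≤∑ with p zero in p₀
... | true  = zero , p₀
... | false = let w , pw = ∑⟦⟧-witness (p ∘ suc) 1≤∑ in suc w , pw

∑⟦⟧-witness-≢ : ∀ {n} (p : Fin n → Bool) → 2 ≤ ∑[ w < n ] ⟦ p w ⟧ →
                ∀ u → ∃ λ w → p w ≡ true × w ≢ u
∑⟦⟧-witness-≢ {suc n} p 2≤∑ zero with p zero
... | true  = let w , pw = ∑⟦⟧-witness (p ∘ suc) (s≤s⁻¹ 2≤∑) in suc w , pw , λ ()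
... | false = let w , pw = ∑⟦⟧-witness (p ∘ suc) (≤-trans (s≤s z≤n) 2≤∑) in suc w , pw , λ ()
∑⟦⟧-witness-≢ {suc n} p 2≤∑ (suc u) with p zero in p₀
... | true  = zero , p₀ , λ ()
... | false = let w , pw , w≢u = ∑⟦⟧-witness-≢ (p ∘ suc) 2≤∑ u
              in suc w , pw , w≢u ∘ Fin.suc-injective

∑ℕ : ℕ → (ℕ → ℕ) → ℕ
∑ℕ n h = ∑[ i < n ] h (toℕ i)

∑ℕ-cong : ∀ n {h h′ : ℕ → ℕ} → (∀ j → j < n → h j ≡ h′ j) → ∑ℕ n h ≡ ∑ℕ n h′
∑ℕ-cong zero    h≡h′ = refl
∑ℕ-cong (suc n) h≡h′ = cong₂ _+_ (h≡h′ 0 z<s) (∑ℕ-cong n λ j j<n → h≡h′ (suc j) (s<s j<n))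

∑ℕ-const : ∀ n c → ∑ℕ n (λ _ → c) ≡ n * c
∑ℕ-const zero    c = refl
∑ℕ-const (suc n) c = cong (c +_) (∑ℕ-const n c)

∑ℕ-+ : ∀ a b h → ∑ℕ (a + b) h ≡ ∑ℕ a h + ∑ℕ b (λ i → h (a + i))
∑ℕ-+ zero    b h = refl
∑ℕ-+ (suc a) b h = trans (cong (h 0 +_) (∑ℕ-+ a b (h ∘ suc))) (sym (+-assoc (h 0) _ _))

∑ℕ-prefix≤ : ∀ a b h → ∑ℕ a h ≤ ∑ℕ (a + b) h
∑ℕ-prefix≤ a b h = subst (∑ℕ a h ≤_) (sym (∑ℕ-+ a b h)) (m≤m+n _ _)

∑ℕ-suffix≤ : ∀ a b h → ∑ℕ b (λ i → h (a + i)) ≤ ∑ℕ (a + b) h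
∑ℕ-suffix≤ a b h = subst (∑ℕ b (λ i → h (a + i)) ≤_) (sym (∑ℕ-+ a b h)) (m≤n+m _ _)

h≤∑ℕ : ∀ {n j} h → j < n → h j ≤ ∑ℕ n h
h≤∑ℕ {n} h j<n = subst (λ i → h i ≤ ∑ℕ n h) (Fin.toℕ-fromℕ< j<n) (f≤∑f (h ∘ toℕ) (fromℕ< j<n))

∑ℕ-snoc : ∀ n h → ∑ℕ (suc n) h ≡ ∑ℕ n h + h n
∑ℕ-snoc n h = begin
  ∑ℕ (suc n) h                ≡⟨ cong (λ m → ∑ℕ m h) (+-comm 1 n) ⟩
  ∑ℕ (n + 1) h                ≡⟨ ∑ℕ-+ n 1 h ⟩
  ∑ℕ n h + (h (n + 0) + 0)    ≡⟨ cong (∑ℕ n h +_) (trans (+-identityʳ _) (cong h (+-identityʳ n))) ⟩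
  ∑ℕ n h + h n                ∎
  where open ≡-Reasoning

∑ℕ-reverse : ∀ n h → ∑ℕ n h ≡ ∑ℕ n (λ k → h (n ∸ suc k))
∑ℕ-reverse zero    h = refl
∑ℕ-reverse (suc n) h = begin
  ∑ℕ (suc n) h                          ≡⟨ ∑ℕ-snoc n h ⟩
  ∑ℕ n h + h n                          ≡⟨ cong (_+ h n) (∑ℕ-reverse n h) ⟩
  ∑ℕ n (λ k → h (n ∸ suc k)) + h n      ≡⟨ +-comm _ (h n) ⟩
  h n + ∑ℕ n (λ k → h (n ∸ suc k))      ∎
  where open ≡-Reasoning

∑ℕ-⟦<ᵇ⟧ : ∀ n d → ∑ℕ n (λ k → ⟦ k <ᵇ d ⟧) ≡ n ⊓ d
∑ℕ-⟦<ᵇ⟧ zero    d       = refl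
∑ℕ-⟦<ᵇ⟧ (suc n) zero    = ∑-zero {n} λ _ → refl
∑ℕ-⟦<ᵇ⟧ (suc n) (suc d) = cong suc (∑ℕ-⟦<ᵇ⟧ n d)

∑ℕ-⟦>ᵇ⟧ : ∀ n k → ∑ℕ n (λ p → ⟦ k <ᵇ p ⟧) ≡ n ∸ suc k
∑ℕ-⟦>ᵇ⟧ zero    k       = refl
∑ℕ-⟦>ᵇ⟧ (suc n) zero    = trans (∑ℕ-const n 1) (*-identityʳ n)
∑ℕ-⟦>ᵇ⟧ (suc n) (suc k) = ∑ℕ-⟦>ᵇ⟧ n k

∑ℕ-odd : ∀ m → ∑ℕ m (λ j → j + j ∸ 1) ≡ (m ∸ 1) * (m ∸ 1)
∑ℕ-odd zero          = refl
∑ℕ-odd (suc zero)    = refl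
∑ℕ-odd (suc (suc t)) = begin
  ∑ℕ (suc (suc t)) (λ j → j + j ∸ 1)          ≡⟨ ∑ℕ-snoc (suc t) (λ j → j + j ∸ 1) ⟩
  ∑ℕ (suc t) (λ j → j + j ∸ 1) + (t + suc t)  ≡⟨ cong₂ _+_ (∑ℕ-odd (suc t)) (+-suc t t) ⟩
  t * t + suc (t + t)                         ≡⟨ square t ⟩
  suc t * suc t                               ∎
  where
  open ≡-Reasoning
  square : ∀ t → t * t + suc (t + t) ≡ suc t * suc t
  square = solve-∀

∑ℕ-id-pair : ∀ t → ∑ℕ (suc t) id + ∑ℕ t id ≡ t * t
∑ℕ-id-pair zero    = refl
∑ℕ-id-pair (suc t) = begin
  ∑ℕ (suc (suc t)) id + ∑ℕ (suc t) id    ≡⟨ cong₂ _+_ (∑ℕ-snoc (suc t) id) (∑ℕ-snoc t id) ⟩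
  a + suc t + (b + t)                    ≡⟨ regroup a b t ⟩
  a + b + (suc t + t)                    ≡⟨ cong (_+ (suc t + t)) (∑ℕ-id-pair t) ⟩
  t * t + (suc t + t)                    ≡⟨ square t ⟩
  suc t * suc t                          ∎
  where
  open ≡-Reasoning
  a = ∑ℕ (suc t) id
  b = ∑ℕ t id
  regroup : ∀ a b t → a + (1 + t) + (b + t) ≡ a + b + ((1 + t) + t)
  regroup = solve-∀
  square : ∀ t → t * t + ((1 + t) + t) ≡ (1 + t) * (1 + t)
  square = solve-∀

-- The closed form

data EvenOdd : ℕ → Set where
  even : ∀ m → EvenOdd (m + m)
  odd  : ∀ m → EvenOdd (suc (m + m))

evenOdd : ∀ n → EvenOdd n
evenOdd zero = even 0
evenOdd (suc n) with evenOdd n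
... | even m = odd m
... | odd m  = subst EvenOdd (cong suc (+-suc m m)) (even (suc m))

m+m≡m*2 : ∀ m → m + m ≡ m * 2
m+m≡m*2 m = trans (cong (m +_) (sym (+-identityʳ m))) (*-comm 2 m)

dmaxFormula-even : ∀ t → dmaxFormula (suc t + suc t) ≡ 3 * t * t + 3 * t + 1
dmaxFormula-even t = begin
  (3 * (t + suc t) ^ 2 + 1 ∸ (suc t + suc t) % 2) / 4   ≡⟨ cong (λ r → (3 * (t + suc t) ^ 2 + 1 ∸ r) / 4) even%2 ⟩
  (3 * (t + suc t) ^ 2 + 1) / 4                          ≡⟨ cong (λ x → (3 * x ^ 2 + 1) / 4) (+-suc t t) ⟩
  (3 * suc (t + t) ^ 2 + 1) / 4                          ≡⟨ cong (_/ 4) (polynomial t) ⟩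
  (3 * t * t + 3 * t + 1) * 4 / 4                        ≡⟨ m*n/n≡m _ 4 ⟩
  3 * t * t + 3 * t + 1                                  ∎
  where
  open ≡-Reasoning
  even%2 : (suc t + suc t) % 2 ≡ 0
  even%2 = trans (cong (_% 2) (m+m≡m*2 (suc t))) (m*n%n≡0 (suc t) 2)
  polynomial : ∀ t → 3 * ((1 + (t + t)) * ((1 + (t + t)) * 1)) + 1 ≡ (3 * t * t + 3 * t + 1) * 4
  polynomial = solve-∀

dmaxFormula-odd : ∀ m → dmaxFormula (suc (m + m)) ≡ 3 * m * m
dmaxFormula-odd m = begin
  (3 * (m + m) ^ 2 + 1 ∸ suc (m + m) % 2) / 4   ≡⟨ cong (λ r → (3 * (m + m) ^ 2 + 1 ∸ r) / 4) odd%2 ⟩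
  (3 * (m + m) ^ 2 + 1 ∸ 1) / 4                 ≡⟨ cong (_/ 4) (trans (m+n∸n≡m _ 1) (polynomial m)) ⟩
  3 * m * m * 4 / 4                             ≡⟨ m*n/n≡m _ 4 ⟩
  3 * m * m                                     ∎
  where
  open ≡-Reasoning
  odd%2 : suc (m + m) % 2 ≡ 1
  odd%2 = trans (cong (λ x → suc x % 2) (m+m≡m*2 m)) ([m+kn]%n≡m%n 1 m 2)
  polynomial : ∀ m → 3 * ((m + m) * ((m + m) * 1)) ≡ 3 * m * m * 4
  polynomial = solve-∀

∑ℕ-window : ∀ n → ∑ℕ n (λ j → n ⊓ (j + j) ∸ 1) ≡ dmaxFormula n
∑ℕ-window n with evenOdd n
... | even m = begin
  ∑ℕ (m + m) (λ j → (m + m) ⊓ (j + j) ∸ 1)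
    ≡⟨ ∑ℕ-+ m m (λ j → (m + m) ⊓ (j + j) ∸ 1) ⟩
  ∑ℕ m (λ j → (m + m) ⊓ (j + j) ∸ 1) + ∑ℕ m (λ i → (m + m) ⊓ ((m + i) + (m + i)) ∸ 1)
    ≡⟨ cong₂ _+_ (∑ℕ-cong m λ j j<m → cong (_∸ 1) (m≥n⇒m⊓n≡n (+-mono-≤ (<⇒≤ j<m) (<⇒≤ j<m))))
                 (∑ℕ-cong m λ i _ → cong (_∸ 1) (m≤n⇒m⊓n≡m (+-mono-≤ (m≤m+n m i) (m≤m+n m i)))) ⟩
  ∑ℕ m (λ j → j + j ∸ 1) + ∑ℕ m (λ _ → m + m ∸ 1)
    ≡⟨ cong₂ _+_ (∑ℕ-odd m) (∑ℕ-const m _) ⟩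
  (m ∸ 1) * (m ∸ 1) + m * (m + m ∸ 1)
    ≡⟨ closed m ⟩
  dmaxFormula (m + m) ∎
  where
  open ≡-Reasoning
  polynomial : ∀ t → t * t + (1 + t) * (t + (1 + t)) ≡ 3 * t * t + 3 * t + 1
  polynomial = solve-∀
  closed : ∀ m → (m ∸ 1) * (m ∸ 1) + m * (m + m ∸ 1) ≡ dmaxFormula (m + m)
  closed zero    = refl
  closed (suc t) = trans (polynomial t) (sym (dmaxFormula-even t))
... | odd m = begin
  ∑ℕ (suc m + m) (λ j → suc (m + m) ⊓ (j + j) ∸ 1)
    ≡⟨ ∑ℕ-+ (suc m) m (λ j → suc (m + m) ⊓ (j + j) ∸ 1) ⟩
  ∑ℕ (suc m) (λ j → suc (m + m) ⊓ (j + j) ∸ 1) + ∑ℕ m (λ i → suc (m + m) ⊓ ((suc m + i) + (suc m + i)) ∸ 1)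
    ≡⟨ cong₂ _+_ (∑ℕ-cong (suc m) λ j j<1+m → cong (_∸ 1) (m≥n⇒m⊓n≡n (m≤n⇒m≤1+n (+-mono-≤ (s≤s⁻¹ j<1+m) (s≤s⁻¹ j<1+m)))))
                 (∑ℕ-cong m λ i _ → cong (_∸ 1) (m≤n⇒m⊓n≡m (+-mono-≤ (m≤m+n (suc m) i) (m≤n⇒m≤1+n (m≤m+n m i))))) ⟩
  ∑ℕ (suc m) (λ j → j + j ∸ 1) + ∑ℕ m (λ _ → m + m)
    ≡⟨ cong₂ _+_ (∑ℕ-odd (suc m)) (∑ℕ-const m (m + m)) ⟩
  m * m + m * (m + m)
    ≡⟨ polynomial m ⟩
  3 * m * m
    ≡⟨ dmaxFormula-odd m ⟨
  dmaxFormula (suc (m + m)) ∎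
  where
  open ≡-Reasoning
  polynomial : ∀ m → m * m + m * (m + m) ≡ 3 * m * m
  polynomial = solve-∀

⌈m+m/2⌉≡m : ∀ m → ⌈ m + m /2⌉ ≡ m
⌈m+m/2⌉≡m m = begin
  (m + m + 1) / 2      ≡⟨ cong (λ x → (x + 1) / 2) (m+m≡m*2 m) ⟩
  (m * 2 + 1) / 2      ≡⟨ +-distrib-/ (m * 2) 1 (subst (λ x → x + 1 < 2) (sym (m*n%n≡0 m 2)) ≤-refl) ⟩
  m * 2 / 2 + 1 / 2    ≡⟨ cong (_+ 0) (m*n/n≡m m 2) ⟩
  m + 0                ≡⟨ +-identityʳ m ⟩
  m                    ∎
  where open ≡-Reasoning

⌈1+m+m/2⌉≡1+m : ∀ m → ⌈ suc (m + m) /2⌉ ≡ suc m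
⌈1+m+m/2⌉≡1+m m = trans (cong (_/ 2) 1+m+m+1≡[1+m]*2) (m*n/n≡m (suc m) 2)
  where
  1+m+m+1≡[1+m]*2 : suc (m + m) + 1 ≡ suc m * 2
  1+m+m+1≡[1+m]*2 = trans (+-comm (suc (m + m)) 1) (trans (cong suc (sym (+-suc m m))) (m+m≡m*2 (suc m)))

n∸[1+[n∸[1+j]]]≡j : ∀ {n j} → j < n → n ∸ suc (n ∸ suc j) ≡ j
n∸[1+[n∸[1+j]]]≡j {suc n} (s≤s j≤n) = m∸[m∸n]≡n j≤n

1+[n∸1+j]≤n : ∀ {n j} → j < n → suc (n ∸ suc j) ≤ n
1+[n∸1+j]≤n {suc n} {j} _ = s≤s (m∸n≤m n j)

-- Paths and cycles

Linked-++⁻ˡ : ∀ {A : Set} {R : A → A → Set} xs ys → Linked R (xs ++ ys) → Linked R xs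
Linked-++⁻ˡ []           ys _          = []
Linked-++⁻ˡ (x ∷ [])     ys _          = [-]
Linked-++⁻ˡ (x ∷ y ∷ xs) ys (Rxy ∷ Rs) = Rxy ∷ Linked-++⁻ˡ (y ∷ xs) ys Rs

Linked-∷ʳ : ∀ {A : Set} {R : A → A → Set} xs y z →
            Linked R (xs ++ [ y ]) → R y z → Linked R ((xs ++ [ y ]) ++ [ z ])
Linked-∷ʳ []            y z _           Ryz = Ryz ∷ [-]
Linked-∷ʳ (x ∷ [])      y z (Rxy ∷ _)   Ryz = Rxy ∷ Ryz ∷ [-]
Linked-∷ʳ (x ∷ x′ ∷ xs) y z (Rxx′ ∷ Rs) Ryz = Rxx′ ∷ Linked-∷ʳ (x′ ∷ xs) y z Rs Ryz

Unique-++⁻ˡ : ∀ {A : Set} (xs ys : List A) → Unique (xs ++ ys) → Unique xs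
Unique-++⁻ˡ []       ys _           = []
Unique-++⁻ˡ (x ∷ xs) ys (x∉ ∷ uniq) = All.++⁻ˡ xs x∉ ∷ Unique-++⁻ˡ xs ys uniq

twoBranchVertices⇒acyclic : ∀ {n} (g : Graph n) (h₁ h₂ : ℕ) → (∀ u v → g u v ≡ g v u) →
  (∀ w x y → Adj g w x → Adj g w y → x ≢ y → toℕ w ≡ h₁ ⊎ toℕ w ≡ h₂) → Acyclic g
twoBranchVertices⇒acyclic {n} g h₁ h₂ g-sym hub [] ()
twoBranchVertices⇒acyclic {n} g h₁ h₂ g-sym hub (a ∷ [])     (() , _)
twoBranchVertices⇒acyclic {n} g h₁ h₂ g-sym hub (a ∷ _ ∷ []) (s≤s () , _)
twoBranchVertices⇒acyclic {n} g h₁ h₂ g-sym hub (a ∷ b ∷ c ∷ rest)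
  (_ , (a∉ ∷ b∉ ∷ c∉ ∷ _) , (ab ∷ bc ∷ links)) = third rest b∉ c∉ links
  where
  Hub : Fin n → Set
  Hub w = toℕ w ≡ h₁ ⊎ toℕ w ≡ h₂
  same : ∀ {x y h} → toℕ x ≡ h → toℕ y ≡ h → x ≡ y
  same x≡h y≡h = Fin.toℕ-injective (trans x≡h (sym y≡h))
  noThreeHubs : ∀ {x y z} → Hub x → Hub y → Hub z → x ≢ y → y ≢ z → x ≢ z → ⊥
  noThreeHubs (inj₁ x₁) (inj₁ y₁) _         x≢y _   _   = x≢y (same x₁ y₁)
  noThreeHubs (inj₂ x₂) (inj₂ y₂) _         x≢y _   _   = x≢y (same x₂ y₂)
  noThreeHubs (inj₁ x₁) (inj₂ _)  (inj₁ z₁) _   _   x≢z = x≢z (same x₁ z₁)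
  noThreeHubs (inj₁ _)  (inj₂ y₂) (inj₂ z₂) _   y≢z _   = y≢z (same y₂ z₂)
  noThreeHubs (inj₂ _)  (inj₁ y₁) (inj₁ z₁) _   y≢z _   = y≢z (same y₁ z₁)
  noThreeHubs (inj₂ x₂) (inj₁ _)  (inj₂ z₂) _   _   x≢z = x≢z (same x₂ z₂)
  flip : ∀ {u v} → Adj g u v → Adj g v u
  flip {u} {v} guv = trans (g-sym v u) guv
  a≢b : a ≢ b
  a≢b = All.head a∉
  a≢c : a ≢ c
  a≢c = All.head (All.tail a∉)
  b≢c : b ≢ c
  b≢c = All.head b∉
  hub-b : Hub b
  hub-b = hub b a c (flip ab) bc a≢c
  -- b, c and a third vertex of the cycle each have two distinct neighbours on it.
  third : ∀ rest → All (b ≢_) (c ∷ rest) → All (c ≢_) rest → Linked (Adj g) (c ∷ rest ++ [ a ]) → ⊥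
  third [] _ _ (ca ∷ [-]) =
    noThreeHubs (hub a b c ab (flip ca) b≢c) hub-b (hub c b a (flip bc) ca (a≢b ∘ sym)) a≢b b≢c a≢c
  third (d ∷ rest) (_ ∷ b≢d ∷ _) (c≢d ∷ c∉rest) (cd ∷ links) =
    noThreeHubs hub-b (hub c b d (flip bc) cd b≢d) (hub-d rest c∉rest links) b≢c c≢d b≢d
    where
    hub-d : ∀ rest → All (c ≢_) rest → Linked (Adj g) (d ∷ rest ++ [ a ]) → Hub d
    hub-d []      _           (da ∷ [-]) = hub d c a (flip cd) da (a≢c ∘ sym)
    hub-d (e ∷ _) (c≢e ∷ _)  (de ∷ _)   = hub d c e (flip cd) de c≢e

-- Induced subgraphs of forests

∣_∣ : ∀ {n} → (Fin n → Bool) → ℕ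
∣_∣ {n} S = ∑[ w < n ] ⟦ S w ⟧

_─_ : ∀ {n} → (Fin n → Bool) → Fin n → (Fin n → Bool)
(S ─ v) w = if does (w Fin.≟ v) then false else S w

degreeIn : ∀ {n} → Graph n → (Fin n → Bool) → Fin n → ℕ
degreeIn {n} g S v = ∑[ w < n ] ⟦ S w ∧ g v w ⟧

adjacentPairs : ∀ {n} → Graph n → (Fin n → Bool) → ℕ
adjacentPairs {n} g S = ∑[ u < n ] ∑[ w < n ] ⟦ S u ∧ S w ∧ g u w ⟧

oriented : ∀ {n} → Graph n → Graph n
oriented g u v = g u v ∧ (toℕ u <ᵇ toℕ v)

∣S∣≡1+∣S─v∣ : ∀ {n} (S : Fin n → Bool) v → S v ≡ true → ∣ S ∣ ≡ suc ∣ S ─ v ∣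
∣S∣≡1+∣S─v∣ {n} S v Sv = begin
  ∣ S ∣                                ≡⟨ sum-cong-≗ split ⟩
  ∑[ w < n ] (δ w + ⟦ (S ─ v) w ⟧)     ≡⟨ ∑-distrib-+ δ (λ w → ⟦ (S ─ v) w ⟧) ⟩
  ∑[ w < n ] δ w + ∣ S ─ v ∣           ≡⟨ cong (_+ ∣ S ─ v ∣) (∑-indicator v 1) ⟩
  suc ∣ S ─ v ∣                        ∎
  where
  open ≡-Reasoning
  δ : Fin n → ℕ
  δ w = if does (w Fin.≟ v) then 1 else 0
  split : ∀ w → ⟦ S w ⟧ ≡ δ w + ⟦ (S ─ v) w ⟧
  split w with w Fin.≟ v
  ... | yes refl = cong ⟦_⟧ Sv
  ... | no _     = refl

m∸1+d≤m : ∀ {d m} → d ≤ 1 → d ≤ m → m ∸ 1 + d ≤ m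
m∸1+d≤m {m = zero}  _   z≤n = z≤n
m∸1+d≤m {m = suc m} d≤1 _   = ≤-trans (+-monoʳ-≤ m d≤1) (≤-reflexive (+-comm m 1))

module SimpleGraph {n} (g : Graph n) (g-sym : ∀ u v → g u v ≡ g v u) (g-irr : ∀ u → g u u ≡ false) where

  open import Data.List.Membership.DecPropositional (Fin._≟_ {n}) using (_∈?_)

  Adj-sym : ∀ {u v} → Adj g u v → Adj g v u
  Adj-sym {u} {v} guv = trans (g-sym v u) guv

  PathIn : (Fin n → Bool) → List (Fin n) → Set
  PathIn S p = Unique p × Linked (Adj g) p × All (λ x → S x ≡ true) p

  offPath : List (Fin n) → ℕ
  offPath p = ∑[ w < n ] ⟦ not (does (w ∈? p)) ⟧

  offPath-∷ : ∀ w p → ¬ w ∈ p → offPath (w ∷ p) < offPath p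
  offPath-∷ w p w∉p = ∑-mono-< (λ x → ⟦not∨⟧≤ (does (x Fin.≟ w)) _) w leaves
    where
    leaves : ⟦ not (does (w ∈? (w ∷ p))) ⟧ < ⟦ not (does (w ∈? p)) ⟧
    leaves rewrite dec-true (w Fin.≟ w) refl | dec-false (w ∈? p) w∉p = s≤s z≤n

  closeCycle : ∀ {S} v u rest w → PathIn S (v ∷ u ∷ rest) → Adj g v w → w ≢ u →
               w ∈ v ∷ u ∷ rest → ∃ (IsCycle g)
  closeCycle v u rest w _ gvw w≢u (here refl) with () ← trans (sym gvw) (g-irr v)
  closeCycle v u rest w _ gvw w≢u (there (here w≡u)) = ⊥-elim (w≢u w≡u)
  closeCycle v u rest w (uniq , linked , _) gvw w≢u (there (there w∈rest))
    with pre , post , refl ← ∈-∃++ w∈rest =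
    cycle , long , Unique-++⁻ˡ cycle post (subst Unique split uniq) ,
    Linked-∷ʳ (v ∷ u ∷ pre) w v (Linked-++⁻ˡ cycle post (subst (Linked (Adj g)) split linked)) (Adj-sym gvw)
    where
    cycle : List (Fin n)
    cycle = v ∷ u ∷ pre ++ [ w ]
    split : v ∷ u ∷ pre ++ w ∷ post ≡ cycle ++ post
    split = cong (λ xs → v ∷ u ∷ xs) (sym (List.++-assoc pre [ w ] post))
    long : 2 ≤ length (u ∷ pre ++ [ w ])
    long = s≤s (subst (1 ≤_) (sym (trans (List.length-++ pre) (+-comm (length pre) 1))) (s≤s z≤n))

  module _ (S : Fin n → Bool)
           (branch : ∀ v u → S v ≡ true → ∃ λ w → (S w ≡ true × Adj g v w) × w ≢ u) where

    extend : ∀ v u rest → PathIn S (v ∷ u ∷ rest) →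
             ∃ (IsCycle g) ⊎ ∃ λ w → PathIn S (w ∷ v ∷ u ∷ rest) × offPath (w ∷ v ∷ u ∷ rest) < offPath (v ∷ u ∷ rest)
    extend v u rest path@(uniq , linked , Sv ∷ inS) with branch v u Sv
    ... | w , (Sw , gvw) , w≢u with w ∈? (v ∷ u ∷ rest)
    ... | yes w∈ = inj₁ (closeCycle v u rest w path gvw w≢u w∈)
    ... | no w∉  = inj₂ (w , (All.¬Any⇒All¬ _ w∉ ∷ uniq , Adj-sym gvw ∷ linked , Sw ∷ Sv ∷ inS) , offPath-∷ w _ w∉)

    walk : ∀ fuel v u rest → offPath (v ∷ u ∷ rest) ≤ fuel → PathIn S (v ∷ u ∷ rest) → ∃ (IsCycle g)
    walk fuel v u rest ≤fuel path with extend v u rest path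
    walk fuel       v u rest ≤fuel path | inj₁ cyc = cyc
    walk zero       v u rest ≤fuel path | inj₂ (w , _ , shorter) = ⊥-elim (n≮0 (≤-trans shorter ≤fuel))
    walk (suc fuel) v u rest ≤fuel path | inj₂ (w , path′ , shorter) =
      walk fuel w v (u ∷ rest) (s≤s⁻¹ (≤-trans shorter ≤fuel)) path′

    branching⇒cycle : ∀ v → S v ≡ true → ∃ (IsCycle g)
    branching⇒cycle v Sv with branch v v Sv
    ... | w , (Sw , gvw) , w≢v =
      walk _ w v [] ≤-refl ((w≢v ∷ []) ∷ [] ∷ [] , Adj-sym gvw ∷ [-] , Sw ∷ Sv ∷ [])

  leaf-or-branching : ∀ S → (∃ λ v → S v ≡ true × degreeIn g S v ≤ 1)
                          ⊎ (∀ v u → S v ≡ true → ∃ λ w → (S w ≡ true × Adj g v w) × w ≢ u)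
  leaf-or-branching S with Fin.any? (λ v → (S v Bool.≟ true) ×-dec (degreeIn g S v ≤? 1))
  ... | yes leaf   = inj₁ leaf
  ... | no no-leaf = inj₂ branch
    where
    branch : ∀ v u → S v ≡ true → ∃ λ w → (S w ≡ true × Adj g v w) × w ≢ u
    branch v u Sv with degreeIn g S v ≤? 1
    ... | yes deg≤1 = ⊥-elim (no-leaf (v , Sv , deg≤1))
    ... | no deg≰1  = let w , Sw∧gvw , w≢u = ∑⟦⟧-witness-≢ (λ w → S w ∧ g v w) (≰⇒> deg≰1) u
                      in w , ∧-true Sw∧gvw , w≢u

  degreeIn-─-self : ∀ S v → degreeIn g S v ≡ degreeIn g (S ─ v) v
  degreeIn-─-self S v = sum-cong-≗ same
    where
    same : ∀ w → ⟦ S w ∧ g v w ⟧ ≡ ⟦ (S ─ v) w ∧ g v w ⟧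
    same w with w Fin.≟ v
    ... | yes refl rewrite g-irr v = cong ⟦_⟧ (Bool.∧-zeroʳ (S v))
    ... | no _     = refl

  degreeIn≤∣∣ : ∀ S v → degreeIn g S v ≤ ∣ S ∣
  degreeIn≤∣∣ S v = ∑-mono-≤ λ w → ⟦∧⟧≤ (S w) (g v w)

  adjacentPairs-─ : ∀ S v → S v ≡ true →
                    adjacentPairs g S ≡ adjacentPairs g (S ─ v) + 2 * degreeIn g (S ─ v) v
  adjacentPairs-─ S v Sv = begin
    adjacentPairs g S                                                ≡⟨ sum-cong-≗ (λ u → sum-cong-≗ (split u)) ⟩
    ∑[ u < n ] ∑[ w < n ] (A u w + B u w + C u w)                    ≡⟨ ∑∑-distrib-+ (λ u w → A u w + B u w) C ⟩
    ∑[ u < n ] ∑[ w < n ] (A u w + B u w) + ∑[ u < n ] ∑[ w < n ] C u w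
                                                                     ≡⟨ cong (_+ ∑[ u < n ] ∑[ w < n ] C u w) (∑∑-distrib-+ A B) ⟩
    adjacentPairs g S′ + ∑[ u < n ] ∑[ w < n ] B u w + ∑[ u < n ] ∑[ w < n ] C u w
                                                                     ≡⟨ cong₂ (λ b c → adjacentPairs g S′ + b + c) B-total C-total ⟩
    adjacentPairs g S′ + d + d                                       ≡⟨ +-assoc _ d d ⟩
    adjacentPairs g S′ + (d + d)                                     ≡⟨ cong (λ x → adjacentPairs g S′ + (d + x)) (+-identityʳ d) ⟨
    adjacentPairs g S′ + 2 * d                                       ∎
    where
    open ≡-Reasoning
    S′ = S ─ v
    d = degreeIn g S′ v
    A B C : Fin n → Fin n → ℕ
    A u w = ⟦ S′ u ∧ S′ w ∧ g u w ⟧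
    B u w = if does (u Fin.≟ v) then ⟦ S′ w ∧ g v w ⟧ else 0
    C u w = if does (w Fin.≟ v) then ⟦ S′ u ∧ g u v ⟧ else 0
    split : ∀ u w → ⟦ S u ∧ S w ∧ g u w ⟧ ≡ A u w + B u w + C u w
    split u w with u Fin.≟ v | w Fin.≟ v
    ... | yes refl | yes refl rewrite g-irr v | Bool.∧-zeroʳ (S v) | Bool.∧-zeroʳ (S v) = refl
    ... | yes refl | no _     rewrite Sv = sym (+-identityʳ _)
    ... | no _     | yes refl rewrite Sv | Bool.∧-zeroʳ (S u) = refl
    ... | no _     | no _     = sym (trans (+-identityʳ _) (+-identityʳ _))
    B-total : ∑[ u < n ] ∑[ w < n ] B u w ≡ d
    B-total = trans (∑-comm B) (sum-cong-≗ λ w → ∑-indicator v ⟦ S′ w ∧ g v w ⟧)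
    C-total : ∑[ u < n ] ∑[ w < n ] C u w ≡ d
    C-total = sum-cong-≗ λ u → trans (∑-indicator v ⟦ S′ u ∧ g u v ⟧) (cong (λ b → ⟦ S′ u ∧ b ⟧) (g-sym u v))

  adjacentPairs-∅ : ∀ S → ∣ S ∣ ≡ 0 → adjacentPairs g S ≡ 0
  adjacentPairs-∅ S ∣S∣≡0 = ∑-zero λ u → ∑-zero λ w → none u w
    where
    none : ∀ u w → ⟦ S u ∧ S w ∧ g u w ⟧ ≡ 0
    none u w with S u in Su
    ... | false = refl
    ... | true  = ⊥-elim (n≮0 (subst₂ (λ b m → ⟦ b ⟧ ≤ m) Su ∣S∣≡0 (f≤∑f (λ x → ⟦ S x ⟧) u)))

  adjacentPairs≤ : Acyclic g → ∀ S → adjacentPairs g S ≤ 2 * (∣ S ∣ ∸ 1)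
  adjacentPairs≤ acyclic S = go ∣ S ∣ S ≤-refl
    where
    go : ∀ size S → ∣ S ∣ ≤ size → adjacentPairs g S ≤ 2 * (∣ S ∣ ∸ 1)
    go size S ∣S∣≤size with ∣ S ∣ in ∣S∣≡ | leaf-or-branching S
    ... | zero  | _ = ≤-reflexive (adjacentPairs-∅ S ∣S∣≡)
    ... | suc m | inj₂ branch with v , Sv ← ∑⟦⟧-witness S (subst (1 ≤_) (sym ∣S∣≡) (s≤s z≤n)) =
      ⊥-elim (uncurry acyclic (branching⇒cycle S branch v Sv))
    go (suc size) S (s≤s m≤size) | suc m | inj₁ (v , Sv , deg≤1) = begin
      adjacentPairs g S                                   ≡⟨ adjacentPairs-─ S v Sv ⟩
      adjacentPairs g (S ─ v) + 2 * degreeIn g (S ─ v) v  ≤⟨ +-monoˡ-≤ _ (go size (S ─ v) (subst (_≤ size) (sym ∣S─v∣≡m) m≤size)) ⟩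
      2 * (∣ S ─ v ∣ ∸ 1) + 2 * degreeIn g (S ─ v) v      ≡⟨ *-distribˡ-+ 2 (∣ S ─ v ∣ ∸ 1) (degreeIn g (S ─ v) v) ⟨
      2 * (∣ S ─ v ∣ ∸ 1 + degreeIn g (S ─ v) v)          ≤⟨ *-monoʳ-≤ 2 (m∸1+d≤m d≤1 (degreeIn≤∣∣ (S ─ v) v)) ⟩
      2 * ∣ S ─ v ∣                                       ≡⟨ cong (2 *_) ∣S─v∣≡m ⟩
      2 * m                                               ∎
      where
      open ≤-Reasoning
      ∣S─v∣≡m : ∣ S ─ v ∣ ≡ m
      ∣S─v∣≡m = suc-injective (trans (sym (∣S∣≡1+∣S─v∣ S v Sv)) ∣S∣≡)
      d≤1 : degreeIn g (S ─ v) v ≤ 1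
      d≤1 = subst (_≤ 1) (degreeIn-─-self S v) deg≤1

  adjacentPairs≡2*oriented : ∀ S → adjacentPairs g S ≡ 2 * adjacentPairs (oriented g) S
  adjacentPairs≡2*oriented S = begin
    adjacentPairs g S                                            ≡⟨ sum-cong-≗ (λ u → sum-cong-≗ (split u)) ⟩
    ∑[ u < n ] ∑[ w < n ] (O u w + O w u)                         ≡⟨ ∑∑-distrib-+ O (λ u w → O w u) ⟩
    adjacentPairs (oriented g) S + ∑[ u < n ] ∑[ w < n ] O w u    ≡⟨ cong (adjacentPairs (oriented g) S +_) (∑-comm O) ⟨
    adjacentPairs (oriented g) S + adjacentPairs (oriented g) S   ≡⟨ cong (adjacentPairs (oriented g) S +_) (+-identityʳ _) ⟨
    2 * adjacentPairs (oriented g) S                             ∎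
    where
    open ≡-Reasoning
    O : Fin n → Fin n → ℕ
    O u w = ⟦ S u ∧ S w ∧ oriented g u w ⟧
    split : ∀ u w → ⟦ S u ∧ S w ∧ g u w ⟧ ≡ O u w + O w u
    split u w with <-cmp (toℕ u) (toℕ w)
    ... | tri< u<w _ w≮u rewrite dec-true (toℕ u <? toℕ w) u<w | dec-false (toℕ w <? toℕ u) w≮u
      | Bool.∧-identityʳ (g u w) | Bool.∧-zeroʳ (g w u) | Bool.∧-zeroʳ (S u) | Bool.∧-zeroʳ (S w) = sym (+-identityʳ _)
    ... | tri≈ _ u≡w _ rewrite Fin.toℕ-injective u≡w | g-irr w | Bool.∧-zeroʳ (S w) | Bool.∧-zeroʳ (S w) = refl
    ... | tri> u≮w _ w<u rewrite dec-true (toℕ w <? toℕ u) w<u | dec-false (toℕ u <? toℕ w) u≮w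
      | g-sym u w | Bool.∧-identityʳ (g w u) | Bool.∧-zeroʳ (g w u) | Bool.∧-zeroʳ (S w) | Bool.∧-zeroʳ (S u)
      = cong ⟦_⟧ (∧-leftComm (S u) (S w) (g w u))

  orientedPairs≤ : Acyclic g → ∀ S → adjacentPairs (oriented g) S ≤ ∣ S ∣ ∸ 1
  orientedPairs≤ acyclic S =
    *-cancelˡ-≤ 2 (subst (_≤ 2 * (∣ S ∣ ∸ 1)) (adjacentPairs≡2*oriented S) (adjacentPairs≤ acyclic S))

-- The upper bound

outer : ℕ → ℕ → ℕ → Bool
outer n k p = (p <ᵇ n ∸ suc k) ∨ (k <ᵇ p)

outerBound : ℕ → ℕ → ℕ
outerBound n k = n ⊓ (n ∸ suc k + (n ∸ suc k))

outer-long≤ : ∀ {n a b} k → a ≤ b → b < n → k < b ∸ a → (outer n k a ∧ outer n k b) ≡ true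
outer-long≤ {n} {a} {b} k a≤b b<n k<b∸a = cong₂ _∧_
  (cong (_∨ (k <ᵇ a)) (dec-true (a <? n ∸ suc k) a<n∸1+k))
  (trans (cong ((b <ᵇ n ∸ suc k) ∨_) (dec-true (k <? b) k<b)) (Bool.∨-zeroʳ _))
  where
  a+1+k≤b : a + suc k ≤ b
  a+1+k≤b = ≤-trans (+-monoʳ-≤ a k<b∸a) (≤-reflexive (m+[n∸m]≡n a≤b))
  a<n∸1+k : a < n ∸ suc k
  a<n∸1+k = m+n≤o⇒m≤o∸n (suc a) (≤-<-trans a+1+k≤b b<n)
  k<b : k < b
  k<b = ≤-trans (m≤n+m (suc k) a) a+1+k≤b

outer-long : ∀ {n a b} k → a < n → b < n → k < ∣ a - b ∣ → (outer n k a ∧ outer n k b) ≡ true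
outer-long {n} {a} {b} k a<n b<n k<∣a-b∣ with ≤-total a b
... | inj₁ a≤b = outer-long≤ k a≤b b<n (subst (k <_) (m≤n⇒∣m-n∣≡n∸m a≤b) k<∣a-b∣)
... | inj₂ b≤a = trans (Bool.∧-comm (outer n k a) (outer n k b))
                       (outer-long≤ k b≤a a<n (subst (k <_) (m≤n⇒∣n-m∣≡n∸m b≤a) k<∣a-b∣))

∑ℕ-outer≤ : ∀ n k → ∑ℕ n (λ p → ⟦ outer n k p ⟧) ≤ outerBound n k
∑ℕ-outer≤ n k = ⊓-glb at-most-n (begin
  ∑ℕ n (λ p → ⟦ outer n k p ⟧)
    ≤⟨ ∑-mono-≤ {n} (λ i → ⟦∨⟧≤ (toℕ i <ᵇ n ∸ suc k) (k <ᵇ toℕ i)) ⟩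
  ∑[ i < n ] (⟦ toℕ i <ᵇ n ∸ suc k ⟧ + ⟦ k <ᵇ toℕ i ⟧)
    ≡⟨ ∑-distrib-+ {n} (λ i → ⟦ toℕ i <ᵇ n ∸ suc k ⟧) (λ i → ⟦ k <ᵇ toℕ i ⟧) ⟩
  ∑ℕ n (λ p → ⟦ p <ᵇ n ∸ suc k ⟧) + ∑ℕ n (λ p → ⟦ k <ᵇ p ⟧)
    ≡⟨ cong₂ _+_ (trans (∑ℕ-⟦<ᵇ⟧ n (n ∸ suc k)) (m≥n⇒m⊓n≡n (m∸n≤m n (suc k)))) (∑ℕ-⟦>ᵇ⟧ n k) ⟩
  n ∸ suc k + (n ∸ suc k) ∎)
  where
  open ≤-Reasoning
  at-most-n : ∑ℕ n (λ p → ⟦ outer n k p ⟧) ≤ n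
  at-most-n = ≤-trans (∑-mono-≤ {n} λ i → ⟦⟧≤1 (outer n k (toℕ i))) (≤-reflexive (trans (∑ℕ-const n 1) (*-identityʳ n)))

∣-∣≡∑ℕ : ∀ {n a b} → a < n → b < n → ∣ a - b ∣ ≡ ∑ℕ n (λ k → ⟦ k <ᵇ ∣ a - b ∣ ⟧)
∣-∣≡∑ℕ {n} {a} {b} a<n b<n =
  sym (trans (∑ℕ-⟦<ᵇ⟧ n _) (m≥n⇒m⊓n≡n (≤-trans (∣m-n∣≤m⊔n a b) (<⇒≤ (⊔-lub a<n b<n)))))

∑ℕ-outerBound : ∀ n → ∑ℕ n (λ k → outerBound n k ∸ 1) ≡ dmaxFormula n
∑ℕ-outerBound n = begin
  ∑ℕ n (λ k → outerBound n k ∸ 1)               ≡⟨ ∑ℕ-reverse n (λ k → outerBound n k ∸ 1) ⟩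
  ∑ℕ n (λ j → outerBound n (n ∸ suc j) ∸ 1)     ≡⟨ ∑ℕ-cong n (λ j j<n → cong (λ i → n ⊓ (i + i) ∸ 1) (n∸[1+[n∸[1+j]]]≡j j<n)) ⟩
  ∑ℕ n (λ j → n ⊓ (j + j) ∸ 1)                  ≡⟨ ∑ℕ-window n ⟩
  dmaxFormula n                                 ∎
  where open ≡-Reasoning

D≡∑ : ∀ {n} (g : Graph n) π →
      D g π ≡ ∑[ u < n ] ∑[ v < n ] (if oriented g u v then ∣ toℕ (π ⟨$⟩ʳ u) - toℕ (π ⟨$⟩ʳ v) ∣ else 0)
D≡∑ {n} g π = trans (ΣFin≡∑ n (λ u → ΣFin n (edgeLength u))) (sum-cong-≗ λ u → ΣFin≡∑ n (edgeLength u))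
  where
  edgeLength : Fin n → Fin n → ℕ
  edgeLength u v = if oriented g u v then ∣ toℕ (π ⟨$⟩ʳ u) - toℕ (π ⟨$⟩ʳ v) ∣ else 0

acyclic⇒D≤dmaxFormula : ∀ {n} (g : Graph n) → IsSimple g → Acyclic g → ∀ π → D g π ≤ dmaxFormula n
acyclic⇒D≤dmaxFormula {n} g (g-sym , g-irr) acyclic π = begin
  D g π                                                 ≡⟨ D≡∑ g π ⟩
  ∑[ u < n ] ∑[ v < n ] edgeLength u v                  ≤⟨ ∑-mono-≤ {n} (λ u → ∑-mono-≤ {n} (edgeLength≤ u)) ⟩
  ∑[ u < n ] ∑[ v < n ] ∑[ k < n ] X u v k              ≡⟨ trans (sum-cong-≗ λ u → ∑-comm (X u)) (∑-comm λ u k → ∑[ v < n ] X u v k) ⟩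
  ∑[ k < n ] adjacentPairs (oriented g) (Outer (toℕ k)) ≤⟨ ∑-mono-≤ {n} (λ k → orientedPairs≤ acyclic (Outer (toℕ k))) ⟩
  ∑[ k < n ] (∣ Outer (toℕ k) ∣ ∸ 1)                    ≤⟨ ∑-mono-≤ {n} (λ k → ∸-monoˡ-≤ 1 (∣Outer∣≤ (toℕ k))) ⟩
  ∑ℕ n (λ k → outerBound n k ∸ 1)                       ≡⟨ ∑ℕ-outerBound n ⟩
  dmaxFormula n                                         ∎
  where
  open ≤-Reasoning
  open SimpleGraph g g-sym g-irr
  pos : Fin n → ℕ
  pos w = toℕ (π ⟨$⟩ʳ w)
  Outer : ℕ → Fin n → Bool
  Outer k w = outer n k (pos w)
  edgeLength : Fin n → Fin n → ℕ
  edgeLength u v = if oriented g u v then ∣ pos u - pos v ∣ else 0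
  X : Fin n → Fin n → Fin n → ℕ
  X u v k = ⟦ Outer (toℕ k) u ∧ Outer (toℕ k) v ∧ oriented g u v ⟧
  ∣Outer∣≤ : ∀ k → ∣ Outer k ∣ ≤ outerBound n k
  ∣Outer∣≤ k = subst (_≤ outerBound n k) (∑-permute (λ p → ⟦ outer n k (toℕ p) ⟧) π) (∑ℕ-outer≤ n k)
  edgeLength≤ : ∀ u v → edgeLength u v ≤ ∑[ k < n ] X u v k
  edgeLength≤ u v with oriented g u v
  ... | false = z≤n
  ... | true  = begin
    ∣ pos u - pos v ∣                                        ≡⟨ ∣-∣≡∑ℕ (Fin.toℕ<n (π ⟨$⟩ʳ u)) (Fin.toℕ<n (π ⟨$⟩ʳ v)) ⟩
    ∑ℕ n (λ k → ⟦ k <ᵇ ∣ pos u - pos v ∣ ⟧)                 ≤⟨ ∑-mono-≤ {n} (λ k → long⇒outer (toℕ k)) ⟩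
    ∑[ k < n ] ⟦ Outer (toℕ k) u ∧ Outer (toℕ k) v ∧ true ⟧  ∎
    where
    long⇒outer : ∀ k → ⟦ k <ᵇ ∣ pos u - pos v ∣ ⟧ ≤ ⟦ Outer k u ∧ Outer k v ∧ true ⟧
    long⇒outer k with k <ᵇ ∣ pos u - pos v ∣ | <ᵇ-reflects-< k ∣ pos u - pos v ∣
    ... | false | _      = z≤n
    ... | true  | ofʸ k< = ≤-reflexive (cong ⟦_⟧ (sym (trans (cong (Outer k u ∧_) (Bool.∧-identityʳ (Outer k v)))
                                                             (outer-long k (Fin.toℕ<n (π ⟨$⟩ʳ u)) (Fin.toℕ<n (π ⟨$⟩ʳ v)) k<))))

-- Bistars

data BistarHalf (k a b : ℕ) : Set where
  firstStar  : a ≡ 0 → 0 < b → b < k → BistarHalf k a b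
  secondStar : a ≡ k → k < b → BistarHalf k a b
  hubEdge    : a ≡ 0 → b ≡ k → BistarHalf k a b

bistarHalf⇒BistarHalf : ∀ k a b → bistarHalf k a b ≡ true → BistarHalf k a b
bistarHalf⇒BistarHalf k a b e with ∨-true {(a ≡ᵇ 0) ∧ (0 <ᵇ b) ∧ (b <ᵇ k)} e
... | inj₁ first = let a≡0 , rest = ∧-true first ; 0<b , b<k = ∧-true rest
                   in firstStar (≡ᵇ-true⇒≡ a≡0) (<ᵇ-true⇒< 0<b) (<ᵇ-true⇒< b<k)
... | inj₂ other with ∨-true {(a ≡ᵇ k) ∧ (k <ᵇ b)} other
...   | inj₁ second = let a≡k , k<b = ∧-true second in secondStar (≡ᵇ-true⇒≡ a≡k) (<ᵇ-true⇒< k<b)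
...   | inj₂ hubs   = let a≡0 , b≡k = ∧-true hubs in hubEdge (≡ᵇ-true⇒≡ a≡0) (≡ᵇ-true⇒≡ b≡k)

bistar-sym : ∀ n k (u v : Fin n) → bistar n k u v ≡ bistar n k v u
bistar-sym n k u v = Bool.∨-comm (bistarHalf k (toℕ u) (toℕ v)) _

bistar-irr : ∀ n k → 1 ≤ k → ∀ (u : Fin n) → bistar n k u u ≡ false
bistar-irr n k 1≤k u with bistarHalf k (toℕ u) (toℕ u) in e
... | false = refl
... | true with bistarHalf⇒BistarHalf k (toℕ u) (toℕ u) e
...   | firstStar  u≡0 0<u _ = ⊥-elim (<-irrefl (sym u≡0) 0<u)
...   | secondStar u≡k k<u   = ⊥-elim (<-irrefl (sym u≡k) k<u)
...   | hubEdge    u≡0 u≡k   = ⊥-elim (<-irrefl (trans (sym u≡0) u≡k) 1≤k)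

bistar-leafNeighbour : ∀ {n k} (a x : Fin n) → toℕ a ≢ 0 → toℕ a ≢ k → Adj (bistar n k) a x →
                       toℕ x ≡ (if toℕ a <ᵇ k then 0 else k)
bistar-leafNeighbour {n} {k} a x a≢0 a≢k e with ∨-true {bistarHalf k (toℕ a) (toℕ x)} e
... | inj₁ ax with bistarHalf⇒BistarHalf k _ _ ax
...   | firstStar  a≡0 _ _ = ⊥-elim (a≢0 a≡0)
...   | secondStar a≡k _   = ⊥-elim (a≢k a≡k)
...   | hubEdge    a≡0 _   = ⊥-elim (a≢0 a≡0)
bistar-leafNeighbour {n} {k} a x a≢0 a≢k e | inj₂ xa with bistarHalf⇒BistarHalf k _ _ xa
...   | firstStar  x≡0 _ a<k = trans x≡0 (cong (if_then 0 else k) (sym (dec-true (toℕ a <? k) a<k)))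
...   | secondStar x≡k k<a   = trans x≡k (cong (if_then 0 else k) (sym (dec-false (toℕ a <? k) (<⇒≯ k<a))))
...   | hubEdge    _   a≡k   = ⊥-elim (a≢k a≡k)

bistar-acyclic : ∀ n k → Acyclic (bistar n k)
bistar-acyclic n k = twoBranchVertices⇒acyclic (bistar n k) 0 k (bistar-sym n k) hub
  where
  hub : ∀ w x y → Adj (bistar n k) w x → Adj (bistar n k) w y → x ≢ y → toℕ w ≡ 0 ⊎ toℕ w ≡ k
  hub w x y wx wy x≢y with toℕ w ≟ 0 | toℕ w ≟ k
  ... | yes w≡0 | _       = inj₁ w≡0
  ... | no _    | yes w≡k = inj₂ w≡k
  ... | no w≢0  | no w≢k  = ⊥-elim (x≢y (Fin.toℕ-injective
          (trans (bistar-leafNeighbour w x w≢0 w≢k wx) (sym (bistar-leafNeighbour w y w≢0 w≢k wy)))))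

-- For the bistar with hubs 0 and k this puts the hubs
-- at the two ends and the leaves of each hub at the far end, next to the other hub.
rotateTail : ℕ → ℕ → ℕ → ℕ
rotateTail k r zero    = 0
rotateTail k r (suc a) = if a <ᵇ k then suc a + r else suc a ∸ k

rotateTail-< : ∀ {k} r {a} → a < k → rotateTail k r (suc a) ≡ suc a + r
rotateTail-< {k} r {a} a<k = cong (if_then suc a + r else suc a ∸ k) (dec-true (a <? k) a<k)

rotateTail-≥ : ∀ {k} r {a} → k ≤ a → rotateTail k r (suc a) ≡ suc a ∸ k
rotateTail-≥ {k} r {a} k≤a = cong (if_then suc a + r else suc a ∸ k) (dec-false (a <? k) (≤⇒≯ k≤a))

rotateTail-bound : ∀ k r {a} → a < suc (k + r) → rotateTail k r a < suc (k + r)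
rotateTail-bound k r {zero}  _ = z<s
rotateTail-bound k r {suc a} (s≤s a<k+r) with a <? k
... | yes a<k = subst (_< suc (k + r)) (sym (rotateTail-< r a<k)) (s≤s (+-monoˡ-< r a<k))
... | no  a≮k = subst (_< suc (k + r)) (sym (rotateTail-≥ r (≮⇒≥ a≮k))) (s≤s (≤-trans (m∸n≤m (suc a) k) a<k+r))

rotateTail-inverse : ∀ k r {a} → a < suc (k + r) → rotateTail r k (rotateTail k r a) ≡ a
rotateTail-inverse k r {zero}  _ = refl
rotateTail-inverse k r {suc a} (s≤s a<k+r) with a <? k
... | yes a<k = begin
  rotateTail r k (rotateTail k r (suc a))  ≡⟨ cong (rotateTail r k) (rotateTail-< r a<k) ⟩
  rotateTail r k (suc (a + r))             ≡⟨ rotateTail-≥ k (m≤n+m r a) ⟩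
  suc (a + r) ∸ r                          ≡⟨ m+n∸n≡m (suc a) r ⟩
  suc a                                    ∎
  where open ≡-Reasoning
... | no a≮k = begin
  rotateTail r k (rotateTail k r (suc a))  ≡⟨ cong (rotateTail r k) (trans (rotateTail-≥ r k≤a) (+-∸-assoc 1 k≤a)) ⟩
  rotateTail r k (suc (a ∸ k))             ≡⟨ rotateTail-< k (subst (a ∸ k <_) (m+n∸m≡n k r) (∸-monoˡ-< a<k+r k≤a)) ⟩
  suc (a ∸ k) + k                          ≡⟨ cong suc (m∸n+n≡m k≤a) ⟩
  suc a                                    ∎
  where
  open ≡-Reasoning
  k≤a : k ≤ a
  k≤a = ≮⇒≥ a≮k

rotation : ∀ k r → Permutation′ (suc (k + r))
rotation k r = permutation to from
  (λ i → Fin.toℕ-injective (trans (toℕ-to (from i)) (trans (cong (rotateTail k r) (toℕ-from i)) (inverse′ (Fin.toℕ<n i)))))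
  (λ i → Fin.toℕ-injective (trans (toℕ-from (to i)) (trans (cong (rotateTail r k) (toℕ-to i)) (rotateTail-inverse k r (Fin.toℕ<n i)))))
  where
  swap : ∀ {a} → a < suc (k + r) → a < suc (r + k)
  swap {a} = subst (λ m → a < suc m) (+-comm k r)
  to from : Fin (suc (k + r)) → Fin (suc (k + r))
  to   i = fromℕ< (rotateTail-bound k r (Fin.toℕ<n i))
  from i = fromℕ< (subst (λ m → rotateTail r k (toℕ i) < suc m) (+-comm r k) (rotateTail-bound r k (swap (Fin.toℕ<n i))))
  toℕ-to : ∀ i → toℕ (to i) ≡ rotateTail k r (toℕ i)
  toℕ-to i = Fin.toℕ-fromℕ< _
  toℕ-from : ∀ i → toℕ (from i) ≡ rotateTail r k (toℕ i)
  toℕ-from i = Fin.toℕ-fromℕ< _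
  inverse′ : ∀ {a} → a < suc (k + r) → rotateTail k r (rotateTail r k a) ≡ a
  inverse′ a< = rotateTail-inverse r k (swap a<)

toℕ-rotation : ∀ k r i → toℕ (rotation k r ⟨$⟩ʳ i) ≡ rotateTail k r (toℕ i)
toℕ-rotation k r i = Fin.toℕ-fromℕ< _

hubEdgeLengths : ℕ → ℕ → ℕ
hubEdgeLengths k r = ∑ℕ k (λ b → suc b + r) + ∑ℕ r (λ i → k + r ∸ suc i)

module _ (k′ r : ℕ) where

  private
    k n : ℕ
    k = suc k′
    n = suc (k + r)

  bistarHalf-hub₁ : ∀ {b} → b < k → bistarHalf k 0 (suc b) ≡ true
  bistarHalf-hub₁ {b} b<k with b <? k′
  ... | yes b<k′ rewrite dec-true (b <? k′) b<k′ = refl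
  ... | no  b≮k′ rewrite dec-false (b <? k′) b≮k′ = dec-true (b ≟ k′) (≤-antisym (s≤s⁻¹ b<k) (≮⇒≥ b≮k′))

  bistarHalf-hub₂ : ∀ i → bistarHalf k k (suc (k + i)) ≡ true
  bistarHalf-hub₂ i rewrite dec-true (k′ ≟ k′) refl | dec-true (k′ <? k + i) (m≤m+n k i) = refl

  rotatedLength : ℕ → ℕ → ℕ
  rotatedLength a b = if (bistarHalf k a b ∨ bistarHalf k b a) ∧ (a <ᵇ b)
                 then ∣ rotateTail k r a - rotateTail k r b ∣ else 0

  rotatedLength-hub₁ : ∀ {b} → b < k → rotatedLength 0 (suc b) ≡ suc b + r
  rotatedLength-hub₁ {b} b<k rewrite bistarHalf-hub₁ b<k = rotateTail-< r b<k

  rotatedLength-hub₂ : ∀ {i} → i < r → rotatedLength k (suc (k + i)) ≡ k + r ∸ suc i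
  rotatedLength-hub₂ {i} i<r rewrite bistarHalf-hub₂ i | dec-true (k′ <? k + i) (m≤m+n k i) = begin
    ∣ rotateTail k r k - rotateTail k r (suc (k + i)) ∣ ≡⟨ cong₂ ∣_-_∣ (rotateTail-< r (n<1+n k′)) (rotateTail-≥ r (m≤m+n k i)) ⟩
    ∣ k + r - suc (k + i) ∸ k ∣                        ≡⟨ cong (λ x → ∣ k + r - x ∣) (trans (+-∸-assoc 1 (m≤m+n k i)) (cong suc (m+n∸m≡n k i))) ⟩
    ∣ k + r - suc i ∣                                  ≡⟨ m≤n⇒∣n-m∣≡n∸m (≤-trans i<r (m≤n+m r k)) ⟩
    k + r ∸ suc i                                      ∎
    where open ≡-Reasoning

  D-rotation≡ : D (bistar n k) (rotation k r) ≡ ∑ℕ n (λ a → ∑ℕ n (rotatedLength a))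
  D-rotation≡ = trans (D≡∑ (bistar n k) (rotation k r)) (sum-cong-≗ λ u → sum-cong-≗ λ v → positions u v)
    where
    positions : ∀ u v → (if oriented (bistar n k) u v
                         then ∣ toℕ (rotation k r ⟨$⟩ʳ u) - toℕ (rotation k r ⟨$⟩ʳ v) ∣ else 0)
                        ≡ rotatedLength (toℕ u) (toℕ v)
    positions u v rewrite toℕ-rotation k r u | toℕ-rotation k r v = refl

  hubEdgeLengths≤D : hubEdgeLengths k r ≤ D (bistar n k) (rotation k r)
  hubEdgeLengths≤D = begin
    hubEdgeLengths k r
      ≡⟨ cong₂ _+_ (∑ℕ-cong k λ b b<k → sym (rotatedLength-hub₁ b<k)) (∑ℕ-cong r λ i i<r → sym (rotatedLength-hub₂ i<r)) ⟩
    ∑ℕ k (rotatedLength 0 ∘ suc) + ∑ℕ r (λ i → rotatedLength k (suc k + i))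
      ≤⟨ +-mono-≤ (≤-trans (∑ℕ-prefix≤ k r (rotatedLength 0 ∘ suc)) (m≤n+m _ (rotatedLength 0 0)))
                  (∑ℕ-suffix≤ (suc k) r (rotatedLength k)) ⟩
    row 0 + row k
      ≤⟨ +-monoʳ-≤ (row 0) (h≤∑ℕ (row ∘ suc) (s≤s (m≤m+n k′ r))) ⟩
    ∑ℕ n row
      ≡⟨ D-rotation≡ ⟨
    D (bistar n k) (rotation k r) ∎
    where
    open ≤-Reasoning
    row : ℕ → ℕ
    row a = ∑ℕ n (rotatedLength a)

hubEdgeLengths≡ : ∀ k r → hubEdgeLengths k r ≡ ∑ℕ k id + k * suc r + (r * k + ∑ℕ r id)
hubEdgeLengths≡ k r = cong₂ _+_ hub₁ hub₂
  where
  hub₁ : ∑ℕ k (λ b → suc b + r) ≡ ∑ℕ k id + k * suc r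
  hub₁ = begin
    ∑ℕ k (λ b → suc b + r)          ≡⟨ ∑ℕ-cong k (λ b _ → sym (+-suc b r)) ⟩
    ∑[ i < k ] (toℕ i + suc r)      ≡⟨ ∑-distrib-+ {k} toℕ (λ _ → suc r) ⟩
    ∑ℕ k id + ∑ℕ k (λ _ → suc r)    ≡⟨ cong (∑ℕ k id +_) (∑ℕ-const k (suc r)) ⟩
    ∑ℕ k id + k * suc r             ∎
    where open ≡-Reasoning
  hub₂ : ∑ℕ r (λ i → k + r ∸ suc i) ≡ r * k + ∑ℕ r id
  hub₂ = begin
    ∑ℕ r (λ i → k + r ∸ suc i)                 ≡⟨ ∑ℕ-reverse r (λ i → k + r ∸ suc i) ⟩
    ∑ℕ r (λ j → k + r ∸ suc (r ∸ suc j))       ≡⟨ ∑ℕ-cong r (λ j j<r → trans (+-∸-assoc k (1+[n∸1+j]≤n j<r)) (cong (k +_) (n∸[1+[n∸[1+j]]]≡j j<r))) ⟩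
    ∑[ j < r ] (k + toℕ j)                     ≡⟨ ∑-distrib-+ {r} (λ _ → k) toℕ ⟩
    ∑ℕ r (λ _ → k) + ∑ℕ r id                   ≡⟨ cong (_+ ∑ℕ r id) (∑ℕ-const r k) ⟩
    r * k + ∑ℕ r id                            ∎
    where open ≡-Reasoning

hubEdgeLengths-even : ∀ t → hubEdgeLengths (suc t) t ≡ dmaxFormula (suc t + suc t)
hubEdgeLengths-even t = begin
  hubEdgeLengths (suc t) t                                  ≡⟨ hubEdgeLengths≡ (suc t) t ⟩
  a + suc t * suc t + (t * suc t + b)                       ≡⟨ regroup a b t ⟩
  a + b + (suc t * suc t + t * suc t)                       ≡⟨ cong (_+ (suc t * suc t + t * suc t)) (∑ℕ-id-pair t) ⟩
  t * t + (suc t * suc t + t * suc t)                       ≡⟨ polynomial t ⟩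
  3 * t * t + 3 * t + 1                                     ≡⟨ dmaxFormula-even t ⟨
  dmaxFormula (suc t + suc t)                               ∎
  where
  open ≡-Reasoning
  a = ∑ℕ (suc t) id
  b = ∑ℕ t id
  regroup : ∀ a b t → a + (1 + t) * (1 + t) + (t * (1 + t) + b) ≡ a + b + ((1 + t) * (1 + t) + t * (1 + t))
  regroup = solve-∀
  polynomial : ∀ t → t * t + ((1 + t) * (1 + t) + t * (1 + t)) ≡ 3 * t * t + 3 * t + 1
  polynomial = solve-∀

hubEdgeLengths-odd : ∀ t → hubEdgeLengths (suc (suc t)) t ≡ dmaxFormula (suc (suc t + suc t))
hubEdgeLengths-odd t = begin
  hubEdgeLengths (suc (suc t)) t                                      ≡⟨ hubEdgeLengths≡ (suc (suc t)) t ⟩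
  ∑ℕ (suc (suc t)) id + suc (suc t) * suc t + (t * suc (suc t) + b)   ≡⟨ cong (λ x → x + suc (suc t) * suc t + (t * suc (suc t) + b)) (∑ℕ-snoc (suc t) id) ⟩
  a + suc t + suc (suc t) * suc t + (t * suc (suc t) + b)             ≡⟨ regroup a b t ⟩
  a + b + (suc t + suc (suc t) * suc t + t * suc (suc t))             ≡⟨ cong (_+ (suc t + suc (suc t) * suc t + t * suc (suc t))) (∑ℕ-id-pair t) ⟩
  t * t + (suc t + suc (suc t) * suc t + t * suc (suc t))             ≡⟨ polynomial t ⟩
  3 * suc t * suc t                                                   ≡⟨ dmaxFormula-odd (suc t) ⟨
  dmaxFormula (suc (suc t + suc t))                                   ∎
  where
  open ≡-Reasoning
  a = ∑ℕ (suc t) id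
  b = ∑ℕ t id
  regroup : ∀ a b t → a + (1 + t) + (2 + t) * (1 + t) + (t * (2 + t) + b)
                      ≡ a + b + ((1 + t) + (2 + t) * (1 + t) + t * (2 + t))
  regroup = solve-∀
  polynomial : ∀ t → t * t + ((1 + t) + (2 + t) * (1 + t) + t * (2 + t)) ≡ 3 * (1 + t) * (1 + t)
  polynomial = solve-∀

rotation-attains : ∀ n k′ r → n ≡ suc (suc k′ + r) → ⌈ n /2⌉ ≡ suc k′ →
                   ∃ λ π → hubEdgeLengths (suc k′) r ≤ D (balancedBistar n) π
rotation-attains _ k′ r refl ⌈n/2⌉≡k =
  subst (λ k → ∃ λ π → hubEdgeLengths (suc k′) r ≤ D (bistar (suc (suc k′ + r)) k) π) (sym ⌈n/2⌉≡k)
        (rotation (suc k′) r , hubEdgeLengths≤D k′ r)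

balancedBistar-attains : ∀ n → 2 ≤ n → ∃ λ π → dmaxFormula n ≤ D (balancedBistar n) π
balancedBistar-attains n 2≤n with evenOdd n
balancedBistar-attains _ ()       | even zero
balancedBistar-attains _ _        | even (suc t) =
  let π , bound = rotation-attains (suc t + suc t) t t (cong suc (+-suc t t)) (⌈m+m/2⌉≡m (suc t))
  in π , subst (_≤ D (balancedBistar (suc t + suc t)) π) (hubEdgeLengths-even t) bound
balancedBistar-attains _ (s≤s ()) | odd zero
balancedBistar-attains _ _        | odd (suc t) =
  let π , bound = rotation-attains (suc (suc t + suc t)) (suc t) t (cong (λ x → suc (suc x)) (+-suc t t)) (⌈1+m+m/2⌉≡1+m (suc t))
  in π , subst (_≤ D (balancedBistar (suc (suc t + suc t))) π) (hubEdgeLengths-odd t) bound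

theorem1 : (n : ℕ) → 2 ≤ n →
    IsDmax (balancedBistar n) (dmaxFormula n) ×
    (∀ (t : Graph n) → IsTree t → ∀ (π : Arrangement n) → D t π ≤ dmaxFormula n)
theorem1 n 2≤n = (attained , bistar-bound) , λ t (simple , _ , acyclic) → acyclic⇒D≤dmaxFormula t simple acyclic
  where
  1≤⌈n/2⌉ : 1 ≤ ⌈ n /2⌉
  1≤⌈n/2⌉ = /-monoˡ-≤ 2 (≤-trans 2≤n (m≤m+n n 1))
  bistar-bound : ∀ π → D (balancedBistar n) π ≤ dmaxFormula n
  bistar-bound = acyclic⇒D≤dmaxFormula (balancedBistar n) (bistar-sym n ⌈ n /2⌉ , bistar-irr n ⌈ n /2⌉ 1≤⌈n/2⌉) (bistar-acyclic n ⌈ n /2⌉)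
  attained : ∃ λ π → D (balancedBistar n) π ≡ dmaxFormula n
  attained = let π , lower = balancedBistar-attains n 2≤n in π , ≤-antisym (bistar-bound π) lower
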